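{- Let $H$ be a hypergraph with an Euler family $\mathcal F$ and incidence graph $G$, and let $G_{\mathcal F}$ be the subgraph of $G$ corresponding to $\mathcal F$. If $C$ is an $\mathcal F$-interchanging cycle of $G$, then there is an Euler family $\mathcal F'$ of $H$ with $G_{\mathcal F'}=G_{\mathcal F}\Delta C$.
   Context: A hypergraph $H=(V,E)$ has a finite non-empty vertex set $V$ and a finite multiset $E$ of subsets of $V$ (edges; distinct members of the multiset are distinct edges). A walk is a sequence $v_0e_1v_1\dots e_mv_m$ with $v_i\in V$, $e_i\in E$, $v_{i-1},v_i\in e_i$, $v_{i-1}\neq v_i$; the $v_i$ are its anchors; it is a trail if the $e_i$ are pairwise distinct, and closed if $v_0=v_m$ and $m\ge2$. An Euler family of $H$ is a set of pairwise anchor-disjoint and edge-disjoint closed trails that together traverse every edge of $H$. The incidence graph $G$ of $H$ is the simple bipartite graph with vertex set $V\cup E$ (elements of $V$ are v-vertices, elements of $E$ are e-vertices), where $v\in V$ and $e\in E$ are adjacent iff $v\in e$. For an Euler family $\mathcal F$, the subgraph corresponding to $\mathcal F$, denoted $G_{\mathcal F}$, is the spanning subgraph of $G$ whose edges are the pairs $ve$ such that $v$ and $e$ occur consecutively (as $\dots ve\dots$ or $\dots ev\dots$) in some closed trail of $\mathcal F$. For simple graphs, $G_1\Delta G_2=(V(G_1)\cup V(G_2),E(G_1)\Delta E(G_2))$, with $E(G_1)\Delta E(G_2)$ the symmetric difference. A cycle $C$ of $G$ is $\mathcal F$-interchanging if every e-vertex of $C$ is incident with exactly one edge of $C$ that lies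 in $G_{\mathcal F}$. -}

module Defs where

open import Data.Nat using (ℕ; zero; suc; _≤_; _<_)
open import Data.Fin using (Fin; zero; suc; inject₁; fromℕ)
open import Data.Fin.Subset using (Subset; _∈_)
open import Data.Product using (Σ; ∃; ∃-syntax; _×_; _,_)
open import Data.Sum using (_⊎_)
open import Relation.Nullary using (¬_)
open import Relation.Binary.PropositionalEquality using (_≡_; _≢_)

_xor_ : Set → Set → Set
P xor Q = (P × ¬ Q) ⊎ (¬ P × Q)

-- A hypergraph: vertex set Fin nV (non-empty), edges indexed by Fin nE
-- (so the edge multiset may contain repeated subsets), edge e = edge e ⊆ V.
record Hypergraph : Set where
  field
    nV       : ℕ
    nE       : ℕ
    nonEmpty : 0 < nV
    edge     : Fin nE → Subset nV
open Hypergraph public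

-- A closed trail v₀ e₁ v₁ … e_len v_len with v₀ = v_len, len ≥ 2.
-- anchor i = v_i (i = 0..len), tedge i = e_{i+1} (i = 0..len-1).
record ClosedTrail (H : Hypergraph) : Set where
  field
    len      : ℕ
    anchor   : Fin (suc len) → Fin (nV H)
    tedge    : Fin len → Fin (nE H)
    inPrev   : ∀ i → anchor (inject₁ i) ∈ edge H (tedge i)
    inNext   : ∀ i → anchor (suc i) ∈ edge H (tedge i)
    distinct : ∀ i → anchor (inject₁ i) ≢ anchor (suc i)
    trail    : ∀ i j → tedge i ≡ tedge j → i ≡ j
    closed   : anchor zero ≡ anchor (fromℕ len)
    long     : 2 ≤ len
open ClosedTrail public

Consecutive : {H : Hypergraph} → ClosedTrail H → Fin (nV H) → Fin (nE H) → Set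
Consecutive T v e =
  ∃[ i ] (tedge T i ≡ e × (anchor T (inject₁ i) ≡ v ⊎ anchor T (suc i) ≡ v))

record EulerFamily (H : Hypergraph) : Set where
  field
    size        : ℕ
    trailOf     : Fin size → ClosedTrail H
    anchorDisj  : ∀ i j → i ≢ j → ∀ a b →
                  anchor (trailOf i) a ≢ anchor (trailOf j) b
    edgeDisj    : ∀ i j → i ≢ j → ∀ a b →
                  tedge (trailOf i) a ≢ tedge (trailOf j) b
    covers      : ∀ e → ∃[ i ] ∃[ a ] tedge (trailOf i) a ≡ e
open EulerFamily public

-- The incidence graph G of H has vertex set V ∪ E and edges ve with v ∈ e;
-- a spanning subgraph of G is given by its edge set, a predicate on
-- pairs (v , e).
IncEdge : (H : Hypergraph) → Fin (nV H) → Fin (nE H) → Set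
IncEdge H v e = v ∈ edge H e

GF : {H : Hypergraph} → EulerFamily H → Fin (nV H) → Fin (nE H) → Set
GF F v e = ∃[ i ] Consecutive (trailOf F i) v e

-- A cycle of the (bipartite) incidence graph G:
-- u₀ f₁ u₁ … f_len u_len with u₀ = u_len, len ≥ 2, the v-vertices
-- u₀ … u_{len-1} pairwise distinct, e-vertices pairwise distinct, and
-- consecutive vertices adjacent in G.
record IncCycle (H : Hypergraph) : Set where
  field
    clen    : ℕ
    cv      : Fin (suc clen) → Fin (nV H)
    ce      : Fin clen → Fin (nE H)
    adjPrev : ∀ i → IncEdge H (cv (inject₁ i)) (ce i)
    adjNext : ∀ i → IncEdge H (cv (suc i)) (ce i)
    cvInj   : ∀ i j → cv (inject₁ i) ≡ cv (inject₁ j) → i ≡ j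
    ceInj   : ∀ i j → ce i ≡ ce j → i ≡ j
    cclosed : cv zero ≡ cv (fromℕ clen)
    clong   : 2 ≤ clen
open IncCycle public

CEdge : {H : Hypergraph} → IncCycle H → Fin (nV H) → Fin (nE H) → Set
CEdge C v e =
  ∃[ i ] (ce C i ≡ e × (cv C (inject₁ i) ≡ v ⊎ cv C (suc i) ≡ v))

-- C is F-interchanging: every e-vertex of C is incident with exactly one
-- edge of C lying in G_F (its two C-edges are u_{i} f_{i+1} and u_{i+1} f_{i+1}).
Interchanging : {H : Hypergraph} → EulerFamily H → IncCycle H → Set
Interchanging F C =
  ∀ i → GF F (cv C (inject₁ i)) (ce C i) xor GF F (cv C (suc i)) (ce C i)

{-# OPTIONS --safe #-}
-- Encode a spanning subgraph of the incidence graph G in which every e-vertex e has degree 2, with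
-- neighbours x and y, by its arc x —e→ y.  The arcs of the trails of an Euler family F encode G_F.
-- Conversely, a loopless arc list using every edge exactly once and meeting every vertex an even
-- number of times splits (Veblen) into closed chains, and closed chains sharing a vertex can be
-- spliced together, so it encodes G_F′ for an Euler family F′.  On an F-interchanging cycle C, the
-- arc of each e-vertex f of C ends at exactly one of the two C-neighbours of f; transposing these
-- two vertices in that arc turns the arcs of G_F into the arcs of G_F Δ C.  Every vertex changes
-- parity by its parity on C, which is even, so G_F Δ C is again of the form G_F′.
module Submission where

open import Defs
open import Algebra.Bundles using (CommutativeMonoid; CommutativeRing)
open import Data.Bool using (Bool; true; false; _∧_) renaming (_xor_ to _⊕_)
open import Data.Bool.Properties
  using (⇔→≡; xor-assoc; xor-comm; xor-same; xor-identityʳ; xor-∧-commutativeRing)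
open import Data.Empty using (⊥-elim)
open import Data.Fin using (Fin; zero; suc; inject₁; fromℕ)
open import Data.Fin.Permutation
  using (Permutation′; transpose; _⟨$⟩ʳ_; _⟨$⟩ˡ_; inverseˡ; inverseʳ)
import Data.Fin.Permutation.Components as PC
import Data.Fin.Properties as Fin
open import Data.Fin.Properties using (any?)
open import Data.Fin.Subset using (Subset) renaming (_∈_ to _∈ₛ_)
open import Data.List
  using (List; []; _∷_; [_]; _++_; concat; concatMap; map; lookup; tabulate; length)
open import Data.List.Properties
  using (++-assoc; length-++-≤ˡ; map-tabulate; tabulate-cong; concat-map; map-∘; map-cong)
open import Data.List.Membership.Propositional using (_∈_; find; lose)
open import Data.List.Membership.Propositional.Properties
  using (∈-lookup; ∈-∃++; ∈-tabulate⁺; ∈-tabulate⁻; ∈-concat⁺′; ∈-map⁺; ∈-map⁻)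
open import Data.List.Relation.Binary.Disjoint.Propositional using (Disjoint)
import Data.List.Relation.Binary.Disjoint.Propositional.Properties as Disjoint
open import Data.List.Relation.Binary.Permutation.Propositional as ↭ using (_↭_; ↭⇒↭ₛ′)
import Data.List.Relation.Binary.Permutation.Propositional.Properties as ↭ₚ
import Data.List.Relation.Binary.Permutation.Setoid as SetoidPermutation
import Data.List.Relation.Binary.Permutation.Setoid.Properties as SetoidPermutationProperties
open import Data.List.Relation.Unary.All as All using (All; []; _∷_)
import Data.List.Relation.Unary.All.Properties as All
open import Data.List.Relation.Unary.AllPairs using (AllPairs; []; _∷_)
import Data.List.Relation.Unary.AllPairs.Properties as AllPairs
open import Data.List.Relation.Unary.Any as Any using (Any; here; there)
import Data.List.Relation.Unary.Any.Properties as Any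
open import Data.List.Relation.Unary.Unique.Propositional using (Unique)
import Data.List.Relation.Unary.Unique.Propositional.Properties as Unique
open import Data.Nat using (zero; suc; _≤_; s≤s; z≤n)
open import Data.Nat.Properties using (≤-refl; ≤-trans; ≤-reflexive; ≤-pred)
open import Data.Product using (Σ; Σ-syntax; ∃; ∃-syntax; _×_; _,_; proj₁; proj₂; swap)
open import Data.Sum as Sum using (_⊎_; inj₁; inj₂)
open import Function using (_∘_)
open import Function.Bundles using (_⇔_; mk⇔; Equivalence)
import Function.Properties.Equivalence as ⇔
open import Function.Related.Propositional using (module EquationalReasoning; equivalence)
open import Level using (0ℓ)
open import Relation.Binary.Bundles using (Setoid)
open import Relation.Binary.Core using (Rel)
open import Relation.Binary.Definitions using (DecidableEquality; Symmetric)
import Relation.Binary.PropositionalEquality as ≡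
open import Relation.Binary.PropositionalEquality
  using (_≡_; _≢_; refl; sym; trans; cong; cong₂; subst; module ≡-Reasoning)
open import Relation.Binary.Structures using (IsEquivalence)
open import Relation.Nullary using (¬_; Dec; yes; no; does; contradiction)
open import Relation.Nullary.Decidable using (dec-true; dec-false)

open import Algebra.Properties.CommutativeSemigroup
  (CommutativeMonoid.commutativeSemigroup
    (CommutativeRing.+-commutativeMonoid xor-∧-commutativeRing))
  using (x∙yz≈y∙xz) renaming (interchange to ⊕-interchange)

xorSum : {A : Set} → (A → Bool) → List A → Bool
xorSum f []       = false
xorSum f (x ∷ xs) = f x ⊕ xorSum f xs

module _ {A : Set} (f : A → Bool) where

  xorSum-++ : ∀ xs ys → xorSum f (xs ++ ys) ≡ xorSum f xs ⊕ xorSum f ys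
  xorSum-++ []       ys = refl
  xorSum-++ (x ∷ xs) ys = trans (cong (f x ⊕_) (xorSum-++ xs ys)) (sym (xor-assoc (f x) _ _))

  xorSum-concat : ∀ xss → xorSum f (concat xss) ≡ xorSum (xorSum f) xss
  xorSum-concat []         = refl
  xorSum-concat (xs ∷ xss) =
    trans (xorSum-++ xs (concat xss)) (cong (xorSum f xs ⊕_) (xorSum-concat xss))

  xorSum-map : ∀ {B : Set} (g : B → A) xs → xorSum f (map g xs) ≡ xorSum (f ∘ g) xs
  xorSum-map g []       = refl
  xorSum-map g (x ∷ xs) = cong (f (g x) ⊕_) (xorSum-map g xs)

  xorSum-↭ : ∀ {xs ys} → xs ↭ ys → xorSum f xs ≡ xorSum f ys
  xorSum-↭ ↭.refl         = refl
  xorSum-↭ (↭.prep x p)   = cong (f x ⊕_) (xorSum-↭ p)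
  xorSum-↭ (↭.swap x y p) = trans (cong (λ s → f x ⊕ f y ⊕ s) (xorSum-↭ p)) (x∙yz≈y∙xz (f x) (f y) _)
  xorSum-↭ (↭.trans p q)  = trans (xorSum-↭ p) (xorSum-↭ q)

  xorSum-false : ∀ {xs} → (∀ {x} → x ∈ xs → f x ≡ false) → xorSum f xs ≡ false
  xorSum-false {[]}     _   = refl
  xorSum-false {x ∷ xs} off = cong₂ _⊕_ (off (here refl)) (xorSum-false (off ∘ there))

  xorSum-unique : ∀ {xs y} → Unique xs → y ∈ xs → (∀ {x} → x ∈ xs → x ≢ y → f x ≡ false) →
                  xorSum f xs ≡ f y
  xorSum-unique {x ∷ xs} (x∉ ∷ _) (here refl) off = begin
    f x ⊕ xorSum f xs ≡⟨ cong (f x ⊕_) (xorSum-false λ x′∈ → off (there x′∈) (All.lookup x∉ x′∈ ∘ sym)) ⟩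
    f x ⊕ false       ≡⟨ xor-identityʳ (f x) ⟩
    f x               ∎
    where open ≡-Reasoning
  xorSum-unique {x ∷ xs} (x∉ ∷ u) (there y∈) off =
    cong₂ _⊕_ (off (here refl) (All.lookup x∉ y∈)) (xorSum-unique u y∈ (off ∘ there))

  xorSum≡true⇒∃ : ∀ {xs} → xorSum f xs ≡ true → ∃ λ x → x ∈ xs × f x ≡ true
  xorSum≡true⇒∃ {x ∷ xs} odd with f x in fx
  ... | true  = x , here refl , fx
  ... | false = let y , y∈ , fy = xorSum≡true⇒∃ odd in y , there y∈ , fy

xorSum-xor : ∀ {A : Set} (f g : A → Bool) xs → xorSum (λ x → f x ⊕ g x) xs ≡ xorSum f xs ⊕ xorSum g xs
xorSum-xor f g []       = refl
xorSum-xor f g (x ∷ xs) =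
  trans (cong ((f x ⊕ g x) ⊕_) (xorSum-xor f g xs)) (⊕-interchange (f x) (g x) _ _)

xorSum-cong : ∀ {A : Set} {f g : A → Bool} {xs} → (∀ {x} → x ∈ xs → f x ≡ g x) →
              xorSum f xs ≡ xorSum g xs
xorSum-cong {xs = []}     _  = refl
xorSum-cong {xs = x ∷ xs} eq = cong₂ _⊕_ (eq (here refl)) (xorSum-cong (eq ∘ there))

xorSum-comm : ∀ {A B : Set} (f : A → B → Bool) xs ys →
              xorSum (λ x → xorSum (f x) ys) xs ≡ xorSum (λ y → xorSum (λ x → f x y) xs) ys
xorSum-comm f []       ys = sym (xorSum-false _ {ys} λ _ → refl)
xorSum-comm f (x ∷ xs) ys =
  trans (cong (xorSum (f x) ys ⊕_) (xorSum-comm f xs ys)) (sym (xorSum-xor (f x) _ ys))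

⊕≡false⇒≡ : ∀ p q → p ⊕ q ≡ false → p ≡ q
⊕≡false⇒≡ false false _ = refl
⊕≡false⇒≡ true  true  _ = refl

⊕-cancelˡ : ∀ {x y z} → x ⊕ y ≡ z → y ≡ x ⊕ z
⊕-cancelˡ {x} {y} refl = begin
  y             ≡⟨⟩
  false ⊕ y     ≡⟨ cong (_⊕ y) (sym (xor-same x)) ⟩
  (x ⊕ x) ⊕ y   ≡⟨ xor-assoc x x y ⟩
  x ⊕ (x ⊕ y)   ∎
  where open ≡-Reasoning

⊕≡true⇔xor : ∀ p q → (p ⊕ q ≡ true) ⇔ ((p ≡ true) xor (q ≡ true))
⊕≡true⇔xor false false = mk⇔ (λ ()) λ { (inj₁ (() , _)) ; (inj₂ (_ , ())) }
⊕≡true⇔xor false true  = mk⇔ (λ _ → inj₂ ((λ ()) , refl)) (λ _ → refl)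
⊕≡true⇔xor true  false = mk⇔ (λ _ → inj₁ (refl , λ ())) (λ _ → refl)
⊕≡true⇔xor true  true  =
  mk⇔ (λ ()) λ { (inj₁ (_ , q≢)) → ⊥-elim (q≢ refl) ; (inj₂ (p≢ , _)) → ⊥-elim (p≢ refl) }

xor-cong : ∀ {P P′ Q Q′ : Set} → P ⇔ P′ → Q ⇔ Q′ → (P xor Q) ⇔ (P′ xor Q′)
xor-cong P⇔P′ Q⇔Q′ = mk⇔
  (λ { (inj₁ (p , ¬q)) → inj₁ (to P⇔P′ p , ¬q ∘ from Q⇔Q′)
     ; (inj₂ (¬p , q)) → inj₂ (¬p ∘ from P⇔P′ , to Q⇔Q′ q) })
  (λ { (inj₁ (p , ¬q)) → inj₁ (from P⇔P′ p , ¬q ∘ to Q⇔Q′)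
     ; (inj₂ (¬p , q)) → inj₂ (¬p ∘ to P⇔P′ , from Q⇔Q′ q) })
  where open Equivalence

xor-sym : ∀ {P Q : Set} → P xor Q → Q xor P
xor-sym (inj₁ pq) = inj₂ (swap pq)
xor-sym (inj₂ pq) = inj₁ (swap pq)

xor-holdsʳ : ∀ {P Q : Set} → Q → (P xor Q) ⇔ (¬ P)
xor-holdsʳ q = mk⇔ (λ { (inj₁ (_ , ¬q)) → ⊥-elim (¬q q) ; (inj₂ (¬p , _)) → ¬p }) (λ ¬p → inj₂ (¬p , q))

xor-failsʳ : ∀ {P Q : Set} → ¬ Q → (P xor Q) ⇔ P
xor-failsʳ ¬q = mk⇔ (λ { (inj₁ (p , _)) → p ; (inj₂ (_ , q)) → ⊥-elim (¬q q) }) (λ p → inj₁ (p , ¬q))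

xor⇒⇔¬ : ∀ {P Q : Set} → P xor Q → Q ⇔ (¬ P)
xor⇒⇔¬ (inj₁ (p , ¬q)) = mk⇔ (⊥-elim ∘ ¬q) (λ ¬p → ⊥-elim (¬p p))
xor⇒⇔¬ (inj₂ (¬p , q)) = mk⇔ (λ _ → ¬p) (λ _ → q)

∈⇒↭∷ : ∀ {A : Set} {x : A} {xs} → x ∈ xs → ∃ λ ys → xs ↭ x ∷ ys
∈⇒↭∷ x∈xs with ys , zs , refl ← ∈-∃++ x∈xs = ys ++ zs , ↭ₚ.shift _ ys zs

AllPairs-lookup : ∀ {A : Set} {R : Rel A 0ℓ} {xs} → AllPairs R xs → Symmetric R →
                  ∀ {i j} → i ≢ j → R (lookup xs i) (lookup xs j)
AllPairs-lookup (_ ∷ _)     R-sym {zero}  {zero}  i≢j = ⊥-elim (i≢j refl)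
AllPairs-lookup (Rx ∷ _)    R-sym {zero}  {suc j} _   = All.lookup Rx (∈-lookup j)
AllPairs-lookup (Rx ∷ _)    R-sym {suc i} {zero}  _   = R-sym (All.lookup Rx (∈-lookup i))
AllPairs-lookup (_ ∷ pairs) R-sym {suc i} {suc j} i≢j = AllPairs-lookup pairs R-sym (i≢j ∘ cong suc)

AllPairs-++⁻ : ∀ {A : Set} {R : Rel A 0ℓ} xs {ys} → AllPairs R (xs ++ ys) →
               AllPairs R xs × AllPairs R ys × All (λ x → All (R x) ys) xs
AllPairs-++⁻ []       pairs        = [] , pairs , []
AllPairs-++⁻ (x ∷ xs) (Rx ∷ pairs) with pxs , pys , cross ← AllPairs-++⁻ xs pairs =
  All.++⁻ˡ xs Rx ∷ pxs , pys , All.++⁻ʳ xs Rx ∷ cross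

Unique-concat⁻ : ∀ {A : Set} xss → Unique {A = A} (concat xss) → All Unique xss × AllPairs Disjoint xss
Unique-concat⁻ []         _ = [] , []
Unique-concat⁻ (xs ∷ xss) u
  with uxs , urest , cross ← AllPairs-++⁻ xs u
  with all , pairs ← Unique-concat⁻ xss urest
  = uxs ∷ all , All.tabulate disjoint ∷ pairs
  where
  disjoint : ∀ {ys} → ys ∈ xss → Disjoint xs ys
  disjoint ys∈xss (v∈xs , v∈ys) = All.lookup (All.lookup cross v∈xs) (∈-concat⁺′ v∈ys ys∈xss) refl

Unique-tabulate⁻ : ∀ {A : Set} {n} {f : Fin n → A} → Unique (tabulate f) → ∀ {i j} → f i ≡ f j → i ≡ j
Unique-tabulate⁻ {n = suc n} _         {zero}  {zero}  _  = refl
Unique-tabulate⁻ {n = suc n} (f₀∉ ∷ _) {zero}  {suc j} eq = ⊥-elim (All.lookup f₀∉ (∈-tabulate⁺ j) eq)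
Unique-tabulate⁻ {n = suc n} (f₀∉ ∷ _) {suc i} {zero}  eq = ⊥-elim (All.lookup f₀∉ (∈-tabulate⁺ i) (sym eq))
Unique-tabulate⁻ {n = suc n} (_ ∷ u)   {suc i} {suc j} eq = cong suc (Unique-tabulate⁻ u eq)

Unique-map⇒injective : ∀ {A B : Set} {f : A → B} {xs x y} → Unique (map f xs) →
                        x ∈ xs → y ∈ xs → f x ≡ f y → x ≡ y
Unique-map⇒injective               _         (here refl) (here refl) _  = refl
Unique-map⇒injective {f = f}       (fx∉ ∷ _) (here refl) (there y∈) eq =
  ⊥-elim (All.lookup fx∉ (∈-map⁺ f y∈) eq)
Unique-map⇒injective {f = f}       (fy∉ ∷ _) (there x∈) (here refl) eq =
  ⊥-elim (All.lookup fy∉ (∈-map⁺ f x∈) (sym eq))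
Unique-map⇒injective               (_ ∷ u)   (there x∈) (there y∈) eq = Unique-map⇒injective u x∈ y∈ eq

transpose-cases : ∀ {n} (i j k : Fin n) →
  (k ≡ i × PC.transpose i j k ≡ j) ⊎ (k ≢ i × k ≡ j × PC.transpose i j k ≡ i) ⊎
  (k ≢ i × k ≢ j × PC.transpose i j k ≡ k)
transpose-cases i j k with k Fin.≟ i
... | yes k≡i = inj₁ (k≡i , refl)
... | no  k≢i with k Fin.≟ j
...   | yes k≡j = inj₂ (inj₁ (k≢i , k≡j , refl))
...   | no  k≢j = inj₂ (inj₂ (k≢i , k≢j , refl))

transpose-∈ : ∀ {n} {S : Subset n} {i j k} → i ∈ₛ S → j ∈ₛ S → k ∈ₛ S → PC.transpose i j k ∈ₛ S
transpose-∈ {S = S} {i} {j} {k} i∈S j∈S k∈S with transpose-cases i j k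
... | inj₁ (_ , moved)            = subst (_∈ₛ S) (sym moved) j∈S
... | inj₂ (inj₁ (_ , _ , moved)) = subst (_∈ₛ S) (sym moved) i∈S
... | inj₂ (inj₂ (_ , _ , fixed)) = subst (_∈ₛ S) (sym fixed) k∈S

⟨$⟩ʳ-injective : ∀ {n} (π : Permutation′ n) {x y} → π ⟨$⟩ʳ x ≡ π ⟨$⟩ʳ y → x ≡ y
⟨$⟩ʳ-injective π same = trans (sym (inverseˡ π)) (trans (cong (π ⟨$⟩ˡ_) same) (inverseˡ π))

-- Arc lists: parity, chains and their decomposition into closed chains

module ArcLists {V E : Set} (_≟ᵥ_ : DecidableEquality V) (_≟ₑ_ : DecidableEquality E) where

  record Arc : Set where
    constructor arc
    field
      src tgt : V
      label   : E
  open Arc public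

  rev : Arc → Arc
  rev (arc x y e) = arc y x e

  rev-involutive : ∀ a → rev (rev a) ≡ a
  rev-involutive (arc _ _ _) = refl

  _≈_ : Rel Arc 0ℓ
  a ≈ b = a ≡ b ⊎ a ≡ rev b

  ≈-isEquivalence : IsEquivalence _≈_
  ≈-isEquivalence = record { refl = inj₁ refl ; sym = ≈-sym ; trans = ≈-trans }
    where
    ≈-sym : ∀ {a b} → a ≈ b → b ≈ a
    ≈-sym         (inj₁ refl) = inj₁ refl
    ≈-sym {b = b} (inj₂ refl) = inj₂ (sym (rev-involutive b))
    ≈-trans : ∀ {a b c} → a ≈ b → b ≈ c → a ≈ c
    ≈-trans (inj₁ refl) b≈c         = b≈c
    ≈-trans (inj₂ refl) (inj₁ refl) = inj₂ refl
    ≈-trans (inj₂ refl) (inj₂ refl) = inj₁ (rev-involutive _)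

  undirected : Setoid 0ℓ 0ℓ
  undirected = record { isEquivalence = ≈-isEquivalence }

  module ↭ᵘ = SetoidPermutation undirected
  module ↭ᵘP = SetoidPermutationProperties undirected
  module ↭ₑ = SetoidPermutation (≡.setoid E)
  module ↭ₑP = SetoidPermutationProperties (≡.setoid E)
  open ↭ᵘ public using () renaming (_↭_ to _↭ᵘ_)
  open ↭ₑ public using () renaming (_↭_ to _↭ₑ_)

  ↭⇒↭ᵘ : ∀ {L M} → L ↭ M → L ↭ᵘ M
  ↭⇒↭ᵘ = ↭⇒↭ₛ′ ≈-isEquivalence

  label-≈ : ∀ {a b} → a ≈ b → label a ≡ label b
  label-≈ (inj₁ refl) = refl
  label-≈ (inj₂ refl) = refl

  labels-↭ᵘ : ∀ {L M} → L ↭ᵘ M → map label L ↭ₑ map label M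
  labels-↭ᵘ = ↭ᵘP.map⁺ (≡.setoid E) label-≈

  Loopless : Arc → Set
  Loopless a = src a ≢ tgt a

  Touches : Arc → V → Set
  Touches a v = src a ≡ v ⊎ tgt a ≡ v

  Touches-resp : ∀ {a v w} → v ≡ w → Touches a v ⇔ Touches a w
  Touches-resp refl = ⇔.refl

  Touches-≈ : ∀ {a b v} → a ≈ b → Touches a v → Touches b v
  Touches-≈ (inj₁ refl) touches      = touches
  Touches-≈ (inj₂ refl) (inj₁ src≡v) = inj₂ src≡v
  Touches-≈ (inj₂ refl) (inj₂ tgt≡v) = inj₁ tgt≡v

  Incidence : List Arc → V → E → Set
  Incidence L v e = Any (λ a → label a ≡ e × Touches a v) L

  Incidence-↭ᵘ : ∀ {L M} → L ↭ᵘ M → ∀ v e → Incidence L v e ⇔ Incidence M v e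
  Incidence-↭ᵘ L↭M v e = mk⇔ (↭ᵘP.Any-resp-↭ resp L↭M) (↭ᵘP.Any-resp-↭ resp (↭ᵘ.↭-sym L↭M))
    where
    resp : ∀ {a b} → a ≈ b → label a ≡ e × Touches a v → label b ≡ e × Touches b v
    resp a≈b (label≡e , touches) = trans (sym (label-≈ a≈b)) label≡e , Touches-≈ a≈b touches

  Incidence-unique : ∀ {L t} → Unique (map label L) → t ∈ L → ∀ v →
                     Incidence L v (label t) ⇔ Touches t v
  Incidence-unique {L} {t} unique t∈L v = mk⇔ to (λ touches → lose t∈L (refl , touches))
    where
    to : Incidence L v (label t) → Touches t v
    to inc with a , a∈L , same-label , touches ← find inc =
      subst (λ x → Touches x v) (Unique-map⇒injective unique a∈L t∈L same-label) touches

  δ : V → V → Bool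
  δ x v = does (x ≟ᵥ v)

  endParity : V → Arc → Bool
  endParity v a = δ (src a) v ⊕ δ (tgt a) v

  parity : V → List Arc → Bool
  parity v = xorSum (endParity v)

  Even : List Arc → Set
  Even L = ∀ v → parity v L ≡ false

  endParity-≈ : ∀ v {a b} → a ≈ b → endParity v a ≡ endParity v b
  endParity-≈ v (inj₁ refl) = refl
  endParity-≈ v {b = arc x y _} (inj₂ refl) = xor-comm (δ y v) (δ x v)

  endParity≡true⇔Touches : ∀ v a → Loopless a → endParity v a ≡ true ⇔ Touches a v
  endParity≡true⇔Touches v a src≢tgt with src a ≟ᵥ v | tgt a ≟ᵥ v
  ... | yes refl  | yes refl  = ⊥-elim (src≢tgt refl)
  ... | yes src≡v | no  _     = mk⇔ (λ _ → inj₁ src≡v) (λ _ → refl)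
  ... | no  _     | yes tgt≡v = mk⇔ (λ _ → inj₂ tgt≡v) (λ _ → refl)
  ... | no  src≢v | no  tgt≢v = mk⇔ (λ ()) λ { (inj₁ src≡v) → ⊥-elim (src≢v src≡v)
                                             ; (inj₂ tgt≡v) → ⊥-elim (tgt≢v tgt≡v) }

  labelParity : V → E → Arc → Bool
  labelParity v e a = does (label a ≟ₑ e) ∧ endParity v a

  xorSum-labelParity⇔Incidence : ∀ {M} → Unique (map label M) → All Loopless M → ∀ v e →
                                 xorSum (labelParity v e) M ≡ true ⇔ Incidence M v e
  xorSum-labelParity⇔Incidence {M} unique loopless v e = mk⇔ to from
    where
    to : xorSum (labelParity v e) M ≡ true → Incidence M v e
    to sum≡true with c , c∈M , _ ← xorSum≡true⇒∃ (labelParity v e) sum≡true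
                with label c ≟ₑ e | endParity v c in odd
    ... | yes label≡e | true =
      lose c∈M (label≡e , Equivalence.to (endParity≡true⇔Touches v c (All.lookup loopless c∈M)) odd)
    from : Incidence M v e → xorSum (labelParity v e) M ≡ true
    from inc with c , c∈M , refl , touches ← find inc = begin
      xorSum (labelParity v (label c)) M        ≡⟨ xorSum-unique _ (Unique.map⁻ unique) c∈M off ⟩
      does (label c ≟ₑ label c) ∧ endParity v c ≡⟨ cong₂ _∧_ (dec-true (label c ≟ₑ label c) refl)
        (Equivalence.from (endParity≡true⇔Touches v c (All.lookup loopless c∈M)) touches) ⟩
      true                                      ∎
      where
      open ≡-Reasoning
      off : ∀ {a} → a ∈ M → a ≢ c → labelParity v (label c) a ≡ false
      off {a} a∈M a≢c = cong (_∧ endParity v a)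
        (dec-false (label a ≟ₑ label c) (a≢c ∘ Unique-map⇒injective unique a∈M c∈M))

  endParity-xor : ∀ {a b M} v → Loopless a → Loopless b → Unique (map label M) → All Loopless M →
                  (Touches b v ⇔ (Touches a v xor Incidence M v (label a))) →
                  endParity v b ≡ endParity v a ⊕ xorSum (labelParity v (label a)) M
  endParity-xor {a} {b} {M} v a-loopless b-loopless unique loopless touches = ⇔→≡ (begin
    endParity v b ≡ true                       ∼⟨ endParity≡true⇔Touches v b b-loopless ⟩
    Touches b v                                ∼⟨ touches ⟩
    (Touches a v xor Incidence M v (label a))
      ∼⟨ xor-cong (⇔.sym (endParity≡true⇔Touches v a a-loopless))
                  (⇔.sym (xorSum-labelParity⇔Incidence unique loopless v (label a))) ⟩
    ((endParity v a ≡ true) xor (xorSum (labelParity v (label a)) M ≡ true))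
                                               ∼⟨ ⇔.sym (⊕≡true⇔xor (endParity v a) _) ⟩
    (endParity v a ⊕ xorSum (labelParity v (label a)) M ≡ true) ∎)
    where open EquationalReasoning {k = equivalence}

  xorSum-labelParity-match : ∀ {L c} v → Unique (map label L) → label c ∈ map label L →
                             xorSum (λ t → labelParity v (label t) c) L ≡ endParity v c
  xorSum-labelParity-match {L} {c} v unique c∈L = begin
    xorSum (λ t → labelParity v (label t) c) L     ≡⟨ xorSum-map (λ e → labelParity v e c) label L ⟨
    xorSum (λ e → labelParity v e c) (map label L) ≡⟨ xorSum-unique (λ e → labelParity v e c) unique c∈L off ⟩
    does (label c ≟ₑ label c) ∧ endParity v c      ≡⟨ cong (_∧ endParity v c) (dec-true (label c ≟ₑ _) refl) ⟩
    endParity v c                                  ∎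
    where
    open ≡-Reasoning
    off : ∀ {e} → e ∈ map label L → e ≢ label c → labelParity v e c ≡ false
    off _ e≢ = cong (_∧ endParity v c) (dec-false (label c ≟ₑ _) (e≢ ∘ sym))

  -- Every arc of M has the label of exactly one arc of L, so the contributions of M can be
  -- regrouped along L.
  parity-symmetricDifference :
    ∀ {L M} (f : Arc → Arc) → Unique (map label L) → Unique (map label M) →
    (∀ {c} → c ∈ M → label c ∈ map label L) →
    All Loopless L → All Loopless M → All Loopless (map f L) →
    (∀ {t} → t ∈ L → ∀ v → Touches (f t) v ⇔ (Touches t v xor Incidence M v (label t))) →
    ∀ v → parity v (map f L) ≡ parity v L ⊕ parity v M
  parity-symmetricDifference {L} {M} f uniqueL uniqueM M⊆L looplessL looplessM looplessfL touches v =
    begin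
    parity v (map f L)                                ≡⟨ xorSum-map (endParity v) f L ⟩
    xorSum (endParity v ∘ f) L                        ≡⟨ xorSum-cong endParity-f ⟩
    xorSum (λ t → endParity v t ⊕ match (label t)) L  ≡⟨ xorSum-xor (endParity v) (match ∘ label) L ⟩
    parity v L ⊕ xorSum (match ∘ label) L
      ≡⟨ cong (parity v L ⊕_) (xorSum-comm (λ t → labelParity v (label t)) L M) ⟩
    parity v L ⊕ xorSum (λ c → xorSum (λ t → labelParity v (label t) c) L) M
      ≡⟨ cong (parity v L ⊕_) (xorSum-cong λ {c} c∈M → xorSum-labelParity-match {c = c} v uniqueL (M⊆L c∈M)) ⟩
    parity v L ⊕ parity v M                           ∎
    where
    open ≡-Reasoning
    match : E → Bool
    match e = xorSum (labelParity v e) M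
    endParity-f : ∀ {t} → t ∈ L → endParity v (f t) ≡ endParity v t ⊕ match (label t)
    endParity-f {t} t∈L = endParity-xor {t} {f t} v (All.lookup looplessL t∈L)
      (All.lookup looplessfL (∈-map⁺ f t∈L)) uniqueM looplessM (touches t∈L v)

  infixr 5 _∷_
  data Chain : V → List Arc → V → Set where
    []  : ∀ {x} → Chain x [] x
    _∷_ : ∀ a {as y} → Chain (tgt a) as y → Chain (src a) (a ∷ as) y

  _++ᶜ_ : ∀ {x m y P Q} → Chain x P m → Chain m Q y → Chain x (P ++ Q) y
  []      ++ᶜ Q = Q
  (a ∷ P) ++ᶜ Q = a ∷ (P ++ᶜ Q)

  splitChain : ∀ {x y} P {Q} → Chain x (P ++ Q) y → ∃ λ m → Chain x P m × Chain m Q y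
  splitChain []      ch       = _ , [] , ch
  splitChain (a ∷ P) (_ ∷ ch) = let m , chP , chQ = splitChain P ch in m , a ∷ chP , chQ

  Chain-nonempty : ∀ {x y P} → x ≢ y → Chain x P y → 1 ≤ length P
  Chain-nonempty x≢y []      = ⊥-elim (x≢y refl)
  Chain-nonempty _   (_ ∷ _) = s≤s z≤n

  parity-Chain : ∀ {x y P} → Chain x P y → ∀ v → parity v P ≡ δ x v ⊕ δ y v
  parity-Chain {x} [] v = sym (xor-same (δ x v))
  parity-Chain {y = y} (_∷_ a {as} ch) v = begin
    (p ⊕ q) ⊕ parity v as ≡⟨ cong ((p ⊕ q) ⊕_) (parity-Chain ch v) ⟩
    (p ⊕ q) ⊕ (q ⊕ r)     ≡⟨ xor-assoc p q (q ⊕ r) ⟩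
    p ⊕ (q ⊕ (q ⊕ r))     ≡⟨ cong (p ⊕_) (sym (xor-assoc q q r)) ⟩
    p ⊕ ((q ⊕ q) ⊕ r)     ≡⟨ cong (λ s → p ⊕ (s ⊕ r)) (xor-same q) ⟩
    p ⊕ r                 ∎
    where
    open ≡-Reasoning
    p = δ (src a) v
    q = δ (tgt a) v
    r = δ y v

  walkArcs : ∀ {n} → (Fin (suc n) → V) → (Fin n → E) → List Arc
  walkArcs anchor lbl = tabulate λ i → arc (anchor (inject₁ i)) (anchor (suc i)) (lbl i)

  walkArcs-chain : ∀ {n} (anchor : Fin (suc n) → V) (lbl : Fin n → E) →
                   Chain (anchor zero) (walkArcs anchor lbl) (anchor (fromℕ n))
  walkArcs-chain {zero}  anchor lbl = []
  walkArcs-chain {suc n} anchor lbl = _ ∷ walkArcs-chain (anchor ∘ suc) (lbl ∘ suc)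

  walkArcs-even : ∀ {n} (anchor : Fin (suc n) → V) (lbl : Fin n → E) →
                  anchor zero ≡ anchor (fromℕ n) → Even (walkArcs anchor lbl)
  walkArcs-even anchor lbl closed v = begin
    parity v (walkArcs anchor lbl)             ≡⟨ parity-Chain (walkArcs-chain anchor lbl) v ⟩
    δ (anchor zero) v ⊕ δ (anchor (fromℕ _)) v ≡⟨ cong (λ x → δ (anchor zero) v ⊕ δ x v) (sym closed) ⟩
    δ (anchor zero) v ⊕ δ (anchor zero) v      ≡⟨ xor-same (δ (anchor zero) v) ⟩
    false                                      ∎
    where open ≡-Reasoning

  labels-walkArcs : ∀ {n} (anchor : Fin (suc n) → V) (lbl : Fin n → E) →
                    map label (walkArcs anchor lbl) ≡ tabulate lbl
  labels-walkArcs anchor lbl = map-tabulate _ label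

  Incidence-walkArcs : ∀ {n} (anchor : Fin (suc n) → V) (lbl : Fin n → E) v e →
    Incidence (walkArcs anchor lbl) v e ⇔ (∃[ i ] (lbl i ≡ e × (anchor (inject₁ i) ≡ v ⊎ anchor (suc i) ≡ v)))
  Incidence-walkArcs anchor lbl v e = mk⇔ Any.tabulate⁻ (λ (i , p) → Any.tabulate⁺ i p)

  anchorAt : (w : V) (L : List Arc) → Fin (suc (length L)) → V
  anchorAt w L       zero    = w
  anchorAt w (a ∷ L) (suc k) = anchorAt (tgt a) L k

  walkArcs-anchorAt : ∀ {w L y} → Chain w L y → walkArcs (anchorAt w L) (label ∘ lookup L) ≡ L
  walkArcs-anchorAt []       = refl
  walkArcs-anchorAt (a ∷ ch) = cong (a ∷_) (walkArcs-anchorAt ch)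

  anchorAt-last : ∀ {w L y} → Chain w L y → anchorAt w L (fromℕ (length L)) ≡ y
  anchorAt-last []       = refl
  anchorAt-last (_ ∷ ch) = anchorAt-last ch

  Visits : List Arc → V → Set
  Visits L v = Any (λ a → src a ≡ v) L

  anchorAt-Visits : ∀ {w L y} → Chain w L y → ∀ (k : Fin (suc (length L))) →
                    Visits L (anchorAt w L k) ⊎ anchorAt w L k ≡ y
  anchorAt-Visits []       zero    = inj₂ refl
  anchorAt-Visits (_ ∷ _)  zero    = inj₁ (here refl)
  anchorAt-Visits (_ ∷ ch) (suc k) = Sum.map₁ there (anchorAt-Visits ch k)

  closedChain-Visits : ∀ {w L} → Chain w L w → 1 ≤ length L → ∀ (k : Fin (suc (length L))) →
                       Visits L (anchorAt w L k)
  closedChain-Visits ch@(_ ∷ _) _ k with anchorAt-Visits ch k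
  ... | inj₁ visits = visits
  ... | inj₂ base   = here (sym base)

  record ClosedChain : Set where
    field
      base       : V
      arcs       : List Arc
      chain      : Chain base arcs base
      nontrivial : 2 ≤ length arcs
  open ClosedChain public

  chainArcs : List ClosedChain → List Arc
  chainArcs = concatMap arcs

  Any-chainArcs : ∀ {P : Arc → Set} R → Any P (chainArcs R) ⇔ Any (Any P ∘ arcs) R
  Any-chainArcs R = mk⇔ (Any.map⁻ ∘ Any.concat⁻ (map arcs R)) (Any.concat⁺ ∘ Any.map⁺)

  Decomposition : List Arc → Set
  Decomposition L = Σ[ cs ∈ List ClosedChain ] chainArcs cs ↭ᵘ L

  PathDecomposition : V → V → List Arc → Set
  PathDecomposition a b L =
    Σ[ P ∈ List Arc ] Chain a P b × Σ[ cs ∈ List ClosedChain ] P ++ chainArcs cs ↭ᵘ L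

  PathParity : V → V → List Arc → Set
  PathParity a b L = ∀ v → parity v L ≡ δ a v ⊕ δ b v

  PathParity⇒odd : ∀ {a b L} → a ≢ b → PathParity a b L → parity b L ≡ true
  PathParity⇒odd {a} {b} a≢b odd =
    trans (odd b) (cong₂ _⊕_ (dec-false (a ≟ᵥ b) a≢b) (dec-true (b ≟ᵥ b) refl))

  Even⇒PathParity : ∀ {t L} → Even (t ∷ L) → PathParity (tgt t) (src t) L
  Even⇒PathParity {t} even v =
    trans (sym (⊕≡false⇒≡ _ _ (even v))) (xor-comm (δ (src t) v) (δ (tgt t) v))

  PathParity-remove : ∀ {a b t a′ L L₀} → L ↭ t ∷ L₀ → a′ ≈ t → tgt a′ ≡ b →
                      PathParity a b L → PathParity a (src a′) L₀
  PathParity-remove {a} {b} {t} {a′} {L} {L₀} L↭ a′≈t refl odd v = begin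
    parity v L₀                                ≡⟨ ⊕-cancelˡ {endParity v t} (sym (xorSum-↭ (endParity v) L↭)) ⟩
    endParity v t ⊕ parity v L                 ≡⟨ cong₂ _⊕_ (sym (endParity-≈ v a′≈t)) (odd v) ⟩
    (δ c v ⊕ δ b v) ⊕ (δ a v ⊕ δ b v)          ≡⟨ ⊕-interchange (δ c v) (δ b v) (δ a v) (δ b v) ⟩
    (δ c v ⊕ δ a v) ⊕ (δ b v ⊕ δ b v)          ≡⟨ cong ((δ c v ⊕ δ a v) ⊕_) (xor-same (δ b v)) ⟩
    (δ c v ⊕ δ a v) ⊕ false                    ≡⟨ xor-identityʳ _ ⟩
    δ c v ⊕ δ a v                              ≡⟨ xor-comm (δ c v) (δ a v) ⟩
    δ a v ⊕ δ c v                              ∎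
    where
    open ≡-Reasoning
    c = src a′

  orientTowards : ∀ {t b} → Touches t b → ∃ λ a → a ≈ t × tgt a ≡ b
  orientTowards {t} (inj₁ src≡b) = rev t , inj₂ refl , src≡b
  orientTowards {t} (inj₂ tgt≡b) = t , inj₁ refl , tgt≡b

  extendPath : ∀ {a b t L L₀} a′ → a′ ≈ t → tgt a′ ≡ b → L ↭ t ∷ L₀ →
               PathDecomposition a (src a′) L₀ → PathDecomposition a b L
  extendPath {t = t} {L} {L₀} a′ a′≈t refl L↭ (P , ch , cs , perm) =
    P ++ [ a′ ] , ch ++ᶜ (a′ ∷ []) , cs , (begin
      (P ++ [ a′ ]) ++ chainArcs cs  ≡⟨ ++-assoc P [ a′ ] (chainArcs cs) ⟩
      P ++ [ a′ ] ++ chainArcs cs    ↭⟨ ↭ᵘP.shift a′≈t P (chainArcs cs) ⟩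
      t ∷ P ++ chainArcs cs          ↭⟨ ↭ᵘ.↭-prep t perm ⟩
      t ∷ L₀                         ↭⟨ ↭⇒↭ᵘ (↭.↭-sym L↭) ⟩
      L                              ∎)
    where open ↭ᵘ.PermutationReasoning

  mutual
    decomposeEven : ∀ k {L} → length L ≤ k → All Loopless L → Even L → Decomposition L
    decomposeEven _       {[]}    _           _                      _    = [] , ↭ᵘ.↭-refl
    decomposeEven (suc k) {t ∷ L} (s≤s |L|≤k) (src≢tgt ∷ loopless) even
      with P , ch , cs , perm ← decomposeOdd k |L|≤k loopless (src≢tgt ∘ sym) (Even⇒PathParity {t} {L} even)
      = cycle ∷ cs , ↭ᵘ.↭-prep t perm
      where
      cycle : ClosedChain
      cycle = record { base = src t ; arcs = t ∷ P ; chain = t ∷ ch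
                     ; nontrivial = s≤s (Chain-nonempty (src≢tgt ∘ sym) ch) }

    -- An arc at b is removed; the rest has its odd vertices at a and at the other end of that arc.
    decomposeOdd : ∀ k {L a b} → length L ≤ k → All Loopless L → a ≢ b → PathParity a b L →
                   PathDecomposition a b L
    decomposeOdd _ {[]} _ _ a≢b odd = contradiction (PathParity⇒odd {L = []} a≢b odd) λ ()
    decomposeOdd zero {_ ∷ _} ()
    decomposeOdd (suc k) {L@(_ ∷ _)} {a} {b} |L|≤1+k loopless a≢b odd
      with t , t∈L , t-odd ← xorSum≡true⇒∃ (endParity b) (PathParity⇒odd {L = L} a≢b odd)
      with a′ , a′≈t , a′↦b ← orientTowards
             (Equivalence.to (endParity≡true⇔Touches b t (All.lookup loopless t∈L)) t-odd)
      with L₀ , L↭ ← ∈⇒↭∷ t∈L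
      = extendPath a′ a′≈t a′↦b L↭ rest
      where
      |L₀|≤k : length L₀ ≤ k
      |L₀|≤k = ≤-pred (≤-trans (≤-reflexive (sym (↭ₚ.↭-length L↭))) |L|≤1+k)
      loopless₀ : All Loopless L₀
      loopless₀ = All.tail (↭ₚ.All-resp-↭ L↭ loopless)
      odd₀ : PathParity a (src a′) L₀
      odd₀ = PathParity-remove L↭ a′≈t a′↦b odd
      rest : PathDecomposition a (src a′) L₀
      rest with src a′ ≟ᵥ a
      ... | yes refl = [] , [] , decomposeEven k |L₀|≤k loopless₀ (λ v → trans (odd₀ v) (xor-same (δ a v)))
      ... | no  c≢a  = decomposeOdd k |L₀|≤k loopless₀ (c≢a ∘ sym) odd₀

  decompose : ∀ {L} → All Loopless L → Even L → Decomposition L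
  decompose = decomposeEven _ ≤-refl

  VertexDisjoint : ClosedChain → ClosedChain → Set
  VertexDisjoint c d = ∀ {v} → ¬ (Visits (arcs c) v × Visits (arcs d) v)

  VertexDisjoint-sym : Symmetric VertexDisjoint
  VertexDisjoint-sym c#d = c#d ∘ swap

  PairwiseVertexDisjoint : List ClosedChain → Set
  PairwiseVertexDisjoint = AllPairs VertexDisjoint

  meet? : ∀ L M → (∃ λ v → Visits L v × Visits M v) ⊎ (∀ {v} → Visits L v → ¬ Visits M v)
  meet? L M with Any.any? (λ a → Any.any? (λ b → src b ≟ᵥ src a) M) L
  ... | yes meet  = let a , a∈L , a∈M = find meet in inj₁ (src a , lose a∈L refl , a∈M)
  ... | no  apart = inj₂ λ vL vM → apart (Any.map (λ { refl → vM }) vL)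

  rotate : ∀ {w L a} → Chain w L w → a ∈ L → ∃ λ L′ → Chain (src a) L′ (src a) × L′ ↭ L
  rotate {a = a} ch a∈L
    with xs , ys , refl ← ∈-∃++ a∈L
    with _ , chXs , (_ ∷ chYs) ← splitChain xs ch
    = (a ∷ ys) ++ xs , (a ∷ chYs) ++ᶜ chXs , ↭ₚ.++-comm (a ∷ ys) xs

  splice : ∀ {v} (c d : ClosedChain) → Visits (arcs c) v → Visits (arcs d) v →
           Σ[ s ∈ ClosedChain ] arcs s ↭ arcs c ++ arcs d
  splice c d vc vd
    with a , a∈c , refl ← find vc
    with b , b∈d , same-src ← find vd
    with Lc , chc , Lc↭ ← rotate (chain c) a∈c
    with Ld , chd , Ld↭ ← rotate (chain d) b∈d
    = record { base = src a ; arcs = Lc ++ Ld ; chain = chc ++ᶜ subst (λ x → Chain x Ld x) same-src chd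
             ; nontrivial = ≤-trans (≤-trans (nontrivial c) (≤-reflexive (sym (↭ₚ.↭-length Lc↭))))
                                    (length-++-≤ˡ Lc) }
    , ↭ₚ.++⁺ Lc↭ Ld↭

  insert : (c : ClosedChain) {R : List ClosedChain} → PairwiseVertexDisjoint R →
           Σ[ R′ ∈ List ClosedChain ] PairwiseVertexDisjoint R′ × chainArcs R′ ↭ arcs c ++ chainArcs R
  insert c {[]} [] = [ c ] , [] ∷ [] , ↭.↭-refl
  insert c {d ∷ R} (d#R ∷ disjoint) with meet? (arcs c) (arcs d)
  ... | inj₁ (v , vc , vd)
    with s , s↭ ← splice c d vc vd
    with R′ , disjoint′ , R′↭ ← insert s disjoint
    = R′ , disjoint′ , (begin
        chainArcs R′                        ↭⟨ R′↭ ⟩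
        arcs s ++ chainArcs R               ↭⟨ ↭ₚ.++⁺ʳ (chainArcs R) s↭ ⟩
        (arcs c ++ arcs d) ++ chainArcs R   ≡⟨ ++-assoc (arcs c) (arcs d) (chainArcs R) ⟩
        arcs c ++ arcs d ++ chainArcs R     ∎)
    where open ↭.PermutationReasoning
  ... | inj₂ c#d
    with R′ , disjoint′ , R′↭ ← insert c disjoint
    = d ∷ R′ , All.tabulate d#e ∷ disjoint′ , (begin
        arcs d ++ chainArcs R′              ↭⟨ ↭ₚ.++⁺ˡ (arcs d) R′↭ ⟩
        arcs d ++ arcs c ++ chainArcs R     ↭⟨ ↭ₚ.shifts (arcs d) (arcs c) ⟩
        arcs c ++ arcs d ++ chainArcs R     ∎)
    where
    open ↭.PermutationReasoning
    d#e : ∀ {e} → e ∈ R′ → VertexDisjoint d e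
    d#e e∈R′ (vd , ve)
      with Any.++⁻ (arcs c) (↭ₚ.Any-resp-↭ R′↭ (Equivalence.from (Any-chainArcs R′) (lose e∈R′ ve)))
    ... | inj₁ vc = c#d vc vd
    ... | inj₂ vR = let d#e′ , ve′ = All.lookupAny d#R (Equivalence.to (Any-chainArcs R) vR) in d#e′ (vd , ve′)

  merge : (cs : List ClosedChain) →
          Σ[ R ∈ List ClosedChain ] PairwiseVertexDisjoint R × chainArcs R ↭ chainArcs cs
  merge []       = [] , [] , ↭.↭-refl
  merge (c ∷ cs)
    with R , disjoint , R↭ ← merge cs
    with R′ , disjoint′ , R′↭ ← insert c disjoint
    = R′ , disjoint′ , ↭.↭-trans R′↭ (↭ₚ.++⁺ˡ (arcs c) R↭)

  disjointDecomposition : ∀ {L} → All Loopless L → Even L →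
                          Σ[ R ∈ List ClosedChain ] PairwiseVertexDisjoint R × chainArcs R ↭ᵘ L
  disjointDecomposition loopless even
    with cs , cs↭ ← decompose loopless even
    with R , disjoint , R↭ ← merge cs
    = R , disjoint , ↭ᵘ.↭-trans (↭⇒↭ᵘ R↭) cs↭

-- Euler families as arc lists

module _ (H : Hypergraph) where

  open ArcLists {Fin (nV H)} {Fin (nE H)} Fin._≟_ Fin._≟_

  Valid : Arc → Set
  Valid a = src a ∈ₛ edge H (label a) × tgt a ∈ₛ edge H (label a) × Loopless a

  Valid-≈ : ∀ {a b} → a ≈ b → Valid a → Valid b
  Valid-≈ (inj₁ refl) valid                = valid
  Valid-≈ (inj₂ refl) (src∈ , tgt∈ , src≢tgt) = tgt∈ , src∈ , src≢tgt ∘ sym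

  record EulerianArcs (L : List Arc) : Set where
    field
      valid  : All Valid L
      even   : Even L
      unique : Unique (map label L)
      covers : ∀ e → e ∈ map label L

  trailArcs : ClosedTrail H → List Arc
  trailArcs T = walkArcs (anchor T) (tedge T)

  Consecutive⇔Incidence : ∀ T v e → Consecutive T v e ⇔ Incidence (trailArcs T) v e
  Consecutive⇔Incidence T v e = ⇔.sym (Incidence-walkArcs (anchor T) (tedge T) v e)

  familyArcs : EulerFamily H → List Arc
  familyArcs F = concat (tabulate (trailArcs ∘ trailOf F))

  GF⇔Incidence : ∀ F v e → GF F v e ⇔ Incidence (familyArcs F) v e
  GF⇔Incidence F v e = mk⇔
    (λ (i , cons) →
      Any.concat⁺ (Any.tabulate⁺ i (Equivalence.to (Consecutive⇔Incidence (trailOf F i) v e) cons)))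
    (λ inc → let i , incᵢ = Any.tabulate⁻ (Any.concat⁻ (tabulate (trailArcs ∘ trailOf F)) inc)
             in i , Equivalence.from (Consecutive⇔Incidence (trailOf F i) v e) incᵢ)

  labels-familyArcs : ∀ F → map label (familyArcs F) ≡ concat (tabulate λ i → tabulate (tedge (trailOf F i)))
  labels-familyArcs F = begin
    map label (concat (tabulate (trailArcs ∘ T)))       ≡⟨ concat-map (tabulate (trailArcs ∘ T)) ⟨
    concat (map (map label) (tabulate (trailArcs ∘ T))) ≡⟨ cong concat (map-tabulate (trailArcs ∘ T) _) ⟩
    concat (tabulate (map label ∘ trailArcs ∘ T))
      ≡⟨ cong concat (tabulate-cong λ i → labels-walkArcs (anchor (T i)) (tedge (T i))) ⟩
    concat (tabulate λ i → tabulate (tedge (T i)))      ∎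
    where
    open ≡-Reasoning
    T = trailOf F

  familyArcs-eulerian : ∀ F → EulerianArcs (familyArcs F)
  familyArcs-eulerian F = record
    { valid  = All.concat⁺ (All.tabulate⁺ λ i → All.tabulate⁺ λ a →
                 inPrev (T i) a , inNext (T i) a , distinct (T i) a)
    ; even   = λ v → trans (xorSum-concat (endParity v) (tabulate (trailArcs ∘ T)))
                           (xorSum-false (parity v) (trail-even v))
    ; unique = subst Unique (sym (labels-familyArcs F))
                 (Unique.concat⁺ (All.tabulate⁺ λ i → Unique.tabulate⁺ (trail (T i) _ _))
                                 (AllPairs.tabulate⁺ edges-disjoint))
    ; covers = λ e → let i , a , tedge≡e = covers F e in
                 subst (_∈ map label (familyArcs F)) tedge≡e
                   (∈-map⁺ label (∈-concat⁺′ (∈-tabulate⁺ a) (∈-tabulate⁺ i)))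
    }
    where
    T = trailOf F
    trail-even : ∀ v {L} → L ∈ tabulate (trailArcs ∘ T) → parity v L ≡ false
    trail-even v L∈ with i , refl ← ∈-tabulate⁻ L∈ =
      walkArcs-even (anchor (T i)) (tedge (T i)) (closed (T i)) v
    edges-disjoint : ∀ {i j} → i ≢ j → Disjoint (tabulate (tedge (T i))) (tabulate (tedge (T j)))
    edges-disjoint i≢j (e∈i , e∈j) with a , refl ← ∈-tabulate⁻ e∈i | b , eq ← ∈-tabulate⁻ e∈j =
      edgeDisj F _ _ i≢j a b eq

  closedTrail : ∀ {n} (anchor : Fin (suc n) → Fin (nV H)) (lbl : Fin n → Fin (nE H)) →
                All Valid (walkArcs anchor lbl) → Unique (tabulate lbl) →
                anchor zero ≡ anchor (fromℕ n) → 2 ≤ n → ClosedTrail H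
  closedTrail {n} anchor lbl valid unique closed long = record
    { len      = n
    ; anchor   = anchor
    ; tedge    = lbl
    ; inPrev   = proj₁ ∘ All.tabulate⁻ valid
    ; inNext   = proj₁ ∘ proj₂ ∘ All.tabulate⁻ valid
    ; distinct = proj₂ ∘ proj₂ ∘ All.tabulate⁻ valid
    ; trail    = λ _ _ → Unique-tabulate⁻ unique
    ; closed   = closed
    ; long     = long
    }

  toClosedTrail : (c : ClosedChain) → All Valid (arcs c) → Unique (map label (arcs c)) → ClosedTrail H
  toClosedTrail c valid unique =
    closedTrail (anchorAt (base c) (arcs c)) (label ∘ lookup (arcs c))
      (subst (All Valid) (sym (walkArcs-anchorAt (chain c))) valid)
      (subst Unique labels unique)
      (sym (anchorAt-last (chain c)))
      (nontrivial c)
    where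
    labels : map label (arcs c) ≡ tabulate (label ∘ lookup (arcs c))
    labels = trans (cong (map label) (sym (walkArcs-anchorAt (chain c))))
                   (labels-walkArcs (anchorAt (base c) (arcs c)) (label ∘ lookup (arcs c)))

  Consecutive-toClosedTrail : ∀ c valid unique v e →
                              Consecutive (toClosedTrail c valid unique) v e ⇔ Incidence (arcs c) v e
  Consecutive-toClosedTrail c valid unique v e =
    subst (λ L → Consecutive (toClosedTrail c valid unique) v e ⇔ Incidence L v e)
          (walkArcs-anchorAt (chain c))
          (Consecutive⇔Incidence (toClosedTrail c valid unique) v e)

  chainFamily : (R : List ClosedChain) → PairwiseVertexDisjoint R → All Valid (chainArcs R) →
                Unique (map label (chainArcs R)) → (∀ e → e ∈ map label (chainArcs R)) →
                Σ[ F ∈ EulerFamily H ] ∀ v e → GF F v e ⇔ Incidence (chainArcs R) v e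
  chainFamily R disjoint valid unique covering = F , GF⇔
    where
    c : Fin (length R) → ClosedChain
    c = lookup R

    labels : map label (chainArcs R) ≡ concat (map (map label ∘ arcs) R)
    labels = trans (sym (concat-map (map arcs R))) (cong concat (sym (map-∘ R)))

    separated : All Unique (map (map label ∘ arcs) R) × AllPairs Disjoint (map (map label ∘ arcs) R)
    separated = Unique-concat⁻ (map (map label ∘ arcs) R) (subst Unique labels unique)

    validᵢ : ∀ i → All Valid (arcs (c i))
    validᵢ i = All.lookup (All.map⁻ (All.concat⁻ {xss = map arcs R} valid)) (∈-lookup i)

    uniqueᵢ : ∀ i → Unique (map label (arcs (c i)))
    uniqueᵢ i = All.lookup (All.map⁻ (proj₁ separated)) (∈-lookup i)

    visitsᵢ : ∀ i k → Visits (arcs (c i)) (anchorAt (base (c i)) (arcs (c i)) k)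
    visitsᵢ i = closedChain-Visits (chain (c i)) (≤-trans (s≤s z≤n) (nontrivial (c i)))

    F : EulerFamily H
    F = record
      { size       = length R
      ; trailOf    = λ i → toClosedTrail (c i) (validᵢ i) (uniqueᵢ i)
      ; anchorDisj = λ i j i≢j a b same →
          -- eta-expanded: arcs is not injective, so the chains cannot be inferred from VertexDisjoint
          AllPairs-lookup disjoint (λ {c₁ c₂} → VertexDisjoint-sym {c₁} {c₂}) i≢j
            (visitsᵢ i a , subst (Visits (arcs (c j))) (sym same) (visitsᵢ j b))
      ; edgeDisj   = λ i j i≢j a b same →
          AllPairs-lookup (AllPairs.map⁻ (proj₂ separated)) Disjoint.sym i≢j
            ( ∈-map⁺ label (∈-lookup a)
            , subst (_∈ map label (arcs (c j))) (sym same) (∈-map⁺ label (∈-lookup b)))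
      ; covers     = λ e →
          let p = Any.map⁻ (Any.concat⁻ (map arcs R) (Any.map⁻ (covering e)))
              q = Any.lookup-index p
          in Any.index p , Any.index q , sym (Any.lookup-index q)
      }

    GF⇔ : ∀ v e → GF F v e ⇔ Incidence (chainArcs R) v e
    GF⇔ v e = mk⇔
      (λ (i , cons) → Equivalence.from (Any-chainArcs R)
        (lose (∈-lookup i) (Equivalence.to (Consecutive-toClosedTrail (c i) (validᵢ i) (uniqueᵢ i) v e) cons)))
      (λ inc → let p = Equivalence.to (Any-chainArcs R) inc; i = Any.index p in
        i , Equivalence.from (Consecutive-toClosedTrail (c i) (validᵢ i) (uniqueᵢ i) v e) (Any.lookup-index p))

  eulerFamily : ∀ {L} → EulerianArcs L → Σ[ F ∈ EulerFamily H ] ∀ v e → GF F v e ⇔ Incidence L v e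
  eulerFamily record { valid = valid ; even = even ; unique = unique ; covers = covering }
    with R , disjoint , R↭L ← disjointDecomposition (All.map (proj₂ ∘ proj₂) valid) even
    with F , GF⇔ ← chainFamily R disjoint
                     (↭ᵘP.All-resp-↭ Valid-≈ (↭ᵘ.↭-sym R↭L) valid)
                     (↭ₑP.Unique-resp-↭ (↭ₑ.↭-sym (labels-↭ᵘ R↭L)) unique)
                     (λ e → ↭ₑP.∈-resp-↭ (↭ₑ.↭-sym (labels-↭ᵘ R↭L)) (covering e))
    = F , λ v e → ⇔.trans (GF⇔ v e) (Incidence-↭ᵘ R↭L v e)

-- Interchanging along an F-interchanging cycle

module Interchange (H : Hypergraph) (F : EulerFamily H) (C : IncCycle H)
                   (interchanging : Interchanging F C) where

  open ArcLists {Fin (nV H)} {Fin (nE H)} Fin._≟_ Fin._≟_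
  open EulerianArcs (familyArcs-eulerian H F)
    renaming (valid to LF-valid; even to LF-even; unique to LF-unique; covers to LF-covers)

  LF : List Arc
  LF = familyArcs H F

  u₀ u₁ : Fin (clen C) → Fin (nV H)
  u₀ i = cv C (inject₁ i)
  u₁ i = cv C (suc i)

  GF⇔Touches : ∀ {t} → t ∈ LF → ∀ v → GF F v (label t) ⇔ Touches t v
  GF⇔Touches t∈LF v = ⇔.trans (GF⇔Incidence H F v _) (Incidence-unique LF-unique t∈LF v)

  touches-one-end : ∀ {t} i → t ∈ LF → ce C i ≡ label t → Touches t (u₀ i) xor Touches t (u₁ i)
  touches-one-end i t∈LF refl =
    Equivalence.to (xor-cong (GF⇔Touches t∈LF (u₀ i)) (GF⇔Touches t∈LF (u₁ i))) (interchanging i)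

  u₀≢u₁ : ∀ i → u₀ i ≢ u₁ i
  u₀≢u₁ i same with interchanging i
  ... | inj₁ (at-u₀ , ¬at-u₁) = ¬at-u₁ (subst (λ x → GF F x (ce C i)) same at-u₀)
  ... | inj₂ (¬at-u₀ , at-u₁) = ¬at-u₀ (subst (λ x → GF F x (ce C i)) (sym same) at-u₁)

  CEdge-at : ∀ {i e} → ce C i ≡ e → ∀ v → CEdge C v e ⇔ (u₀ i ≡ v ⊎ u₁ i ≡ v)
  CEdge-at {i} ce≡e v = mk⇔ to (λ ends → i , ce≡e , ends)
    where
    to : CEdge C v _ → u₀ i ≡ v ⊎ u₁ i ≡ v
    to (j , ce≡e′ , ends) with ceInj C j i (trans ce≡e′ (sym ce≡e))
    ... | refl = ends

  cycleArcs : List Arc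
  cycleArcs = walkArcs (cv C) (ce C)

  CEdge⇔Incidence : ∀ v e → CEdge C v e ⇔ Incidence cycleArcs v e
  CEdge⇔Incidence v e = ⇔.sym (Incidence-walkArcs (cv C) (ce C) v e)

  cycleArcs-unique : Unique (map label cycleArcs)
  cycleArcs-unique = subst Unique (sym (labels-walkArcs (cv C) (ce C))) (Unique.tabulate⁺ (ceInj C _ _))

  permuteEnds : Permutation′ (nV H) → Arc → Arc
  permuteEnds π a = arc (π ⟨$⟩ʳ src a) (π ⟨$⟩ʳ tgt a) (label a)

  Touches-permuteEnds : ∀ π t v → Touches (permuteEnds π t) v ⇔ Touches t (π ⟨$⟩ˡ v)
  Touches-permuteEnds π t v = mk⇔ (Sum.map moved moved) (Sum.map back back)
    where
    moved : ∀ {x} → π ⟨$⟩ʳ x ≡ v → x ≡ π ⟨$⟩ˡ v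
    moved refl = sym (inverseˡ π)
    back : ∀ {x} → x ≡ π ⟨$⟩ˡ v → π ⟨$⟩ʳ x ≡ v
    back refl = inverseʳ π

  onCycle? : ∀ e → Dec (∃ λ i → ce C i ≡ e)
  onCycle? e = any? λ i → ce C i Fin.≟ e

  -- The arc of an e-vertex of C ends at exactly one of its two C-neighbours (touches-one-end), so
  -- transposing them replaces its G_F-edge by the other C-edge.
  interchange : Arc → Arc
  interchange t with onCycle? (label t)
  ... | yes (i , _) = permuteEnds (transpose (u₀ i) (u₁ i)) t
  ... | no  _       = t

  label-interchange : ∀ t → label (interchange t) ≡ label t
  label-interchange t with onCycle? (label t)
  ... | yes _ = refl
  ... | no  _ = refl

  Valid-interchange : ∀ {t} → Valid H t → Valid H (interchange t)
  Valid-interchange {t} valid@(src∈ , tgt∈ , src≢tgt) with onCycle? (label t)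
  ... | no  _         = valid
  ... | yes (i , ce≡) = transpose-∈ u₀∈ u₁∈ src∈ , transpose-∈ u₀∈ u₁∈ tgt∈ ,
                        src≢tgt ∘ ⟨$⟩ʳ-injective (transpose (u₀ i) (u₁ i))
    where
    u₀∈ = subst (λ e → u₀ i ∈ₛ edge H e) ce≡ (adjPrev C i)
    u₁∈ = subst (λ e → u₁ i ∈ₛ edge H e) ce≡ (adjNext C i)

  Touches-interchange : ∀ {t} → t ∈ LF → ∀ v →
                        Touches (interchange t) v ⇔ (Touches t v xor CEdge C v (label t))
  Touches-interchange {t} t∈LF v with onCycle? (label t)
  ... | no  off-cycle   = ⇔.sym (xor-failsʳ λ (i , ce≡ , _) → off-cycle (i , ce≡))
  ... | yes (i , ce≡) = ⇔.trans (Touches-permuteEnds (transpose (u₀ i) (u₁ i)) t v) transposed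
    where
    one-end = touches-one-end i t∈LF ce≡
    on-C = CEdge-at ce≡ v
    transposed : Touches t (PC.transpose (u₁ i) (u₀ i) v) ⇔ (Touches t v xor CEdge C v (label t))
    transposed with transpose-cases (u₁ i) (u₀ i) v
    ... | inj₁ (refl , moved) = ⇔.trans (Touches-resp {t} moved)
      (⇔.trans (xor⇒⇔¬ (xor-sym one-end)) (⇔.sym (xor-holdsʳ (Equivalence.from on-C (inj₂ refl)))))
    ... | inj₂ (inj₁ (_ , refl , moved)) = ⇔.trans (Touches-resp {t} moved)
      (⇔.trans (xor⇒⇔¬ one-end) (⇔.sym (xor-holdsʳ (Equivalence.from on-C (inj₁ refl)))))
    ... | inj₂ (inj₂ (v≢u₁ , v≢u₀ , fixed)) = ⇔.trans (Touches-resp {t} fixed)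
      (⇔.sym (xor-failsʳ λ c → Sum.[ v≢u₀ ∘ sym , v≢u₁ ∘ sym ] (Equivalence.to on-C c)))

  interchanged : List Arc
  interchanged = map interchange LF

  labels-interchanged : map label interchanged ≡ map label LF
  labels-interchanged = trans (sym (map-∘ LF)) (map-cong label-interchange LF)

  interchanged-valid : All (Valid H) interchanged
  interchanged-valid = All.map⁺ (All.map Valid-interchange LF-valid)

  interchanged-even : Even interchanged
  interchanged-even v = trans
    (parity-symmetricDifference interchange LF-unique cycleArcs-unique (λ _ → LF-covers _)
      (All.map (proj₂ ∘ proj₂) LF-valid) (All.tabulate⁺ u₀≢u₁) (All.map (proj₂ ∘ proj₂) interchanged-valid)
      (λ t∈LF v → ⇔.trans (Touches-interchange t∈LF v) (xor-cong ⇔.refl (CEdge⇔Incidence v _))) v)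
    (cong₂ _⊕_ (LF-even v) (walkArcs-even (cv C) (ce C) (cclosed C) v))

  interchanged-eulerian : EulerianArcs H interchanged
  interchanged-eulerian = record
    { valid  = interchanged-valid
    ; even   = interchanged-even
    ; unique = subst Unique (sym labels-interchanged) LF-unique
    ; covers = λ e → subst (e ∈_) (sym labels-interchanged) (LF-covers e)
    }

  Incidence-interchanged : ∀ v e → Incidence interchanged v e ⇔ (GF F v e xor CEdge C v e)
  Incidence-interchanged v e with t , t∈LF , refl ← ∈-map⁻ label (LF-covers e) = begin
    Incidence interchanged v (label t)               ≡⟨ cong (Incidence interchanged v) (label-interchange t) ⟨
    Incidence interchanged v (label (interchange t))
      ∼⟨ Incidence-unique (EulerianArcs.unique interchanged-eulerian) (∈-map⁺ interchange t∈LF) v ⟩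
    Touches (interchange t) v                        ∼⟨ Touches-interchange t∈LF v ⟩
    (Touches t v xor CEdge C v (label t))            ∼⟨ xor-cong (⇔.sym (GF⇔Touches t∈LF v)) ⇔.refl ⟩
    (GF F v (label t) xor CEdge C v (label t))       ∎
    where open EquationalReasoning {k = equivalence}

lemma4p3 : (H : Hypergraph) (F : EulerFamily H) (C : IncCycle H) →
    Interchanging F C →
    Σ (EulerFamily H) λ F′ → (∀ v e → GF F′ v e ⇔ (GF F v e xor CEdge C v e))
lemma4p3 H F C interchanging =
  let F′ , GF′⇔ = eulerFamily H interchanged-eulerian
  in F′ , λ v e → ⇔.trans (GF′⇔ v e) (Incidence-interchanged v e)
  where open Interchange H F C interchanging
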